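{- Let $G$ be a minimum counterexample (for given integers $t,\Delta$ with $3 \le t \le \Delta+1$), with $|E(G)| = q\binom{\Delta+1}{2}+\binom{r}{2}+s$ as in its definition. Then $r \ge 2$.
   Context: All graphs are finite, simple, and without isolated vertices (graphs are identified if isomorphic after deleting isolated vertices). $k_t(H)$ is the number of copies of $K_t$ in $H$; $\binom{y}{k}=y(y-1)\cdots(y-k+1)/k!$. For $m=\binom{r}{2}+s$ with $0\le s<r$, the colex graph $L_m$ is a clique $K_r$ plus one extra vertex adjacent to exactly $s$ clique vertices ($L_0$ empty). The family $\mathcal{L}_{t,\Delta}(m)$: for $m=0$ it is the empty graph; for $0<m\le\binom{\Delta+1}{2}$, $m=\binom{r}{2}+s$, $0\le s<r$: if $s\ge t-1$ it is $\{L_m\}$; if $r\ge t$, $s<t-1$ it is $L_m$ and all $m$-edge graphs of maximum degree $\le\Delta$ containing $K_r$; if $r<t$ it is $L_m$ and all $m$-edge graphs of maximum degree $\le\Delta$. Fix integers $3\le t\le \Delta+1$. A minimum counterexample is a graph $G$ such that: (i) $G$ has maximum degree at most $\Delta$; (ii) $|E(G)| = q\binom{\Delta+1}{2}+\binom{r}{2}+s$ with integers $q\ge 1$ and $0\le s<r\le\Delta$; (iii) $k_t(G)\ge T_t:=q\binom{\Delta+1}{t}+\binom{r}{t}+\binom{s}{t-1}$; (iv) $G$ is not isomorphic to $qK_{\Delta+1}\cup L$ for any $L\in\mathcal{L}_{t,\Delta}(\binom{r}{2}+s)$; (v) every graph $G'$ of maximum degree $\le \Delta$ with fewer edges than $G$,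 writing $|E(G')|=q'\binom{\Delta+1}{2}+b'$ with $0\le b'<\binom{\Delta+1}{2}$, satisfies $k_t(G')\le k_t(q'K_{\Delta+1}\cup L_{b'})$, with equality only if $G'\cong q'K_{\Delta+1}\cup L$ for some $L\in\mathcal{L}_{t,\Delta}(b')$; (vi) every graph with maximum degree $\le\Delta$ and the same number of edges as $G$ has at most $k_t(G)$ copies of $K_t$. -}

module Defs where

open import Data.Nat using (ℕ; zero; suc; _+_; _*_; _∸_; _≤_; _<_; _<ᵇ_)
open import Data.Nat.Combinatorics using (_C_)
open import Data.Bool using (Bool; true; false; _∧_; _∨_; not)
open import Data.Bool.Properties using (∧-comm; ∨-comm)
open import Data.Empty using (⊥-elim)
open import Data.Fin using (Fin; toℕ; _↑ˡ_; _↑ʳ_; splitAt; _≟_)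
open import Data.Sum using (_⊎_; inj₁; inj₂)
open import Data.Product using (Σ; _×_; _,_)
open import Data.List using (List; []; _∷_; filter)
open import Data.List.Base using (allFin)
open import Relation.Nullary using (¬_; does; yes; no)
open import Relation.Binary.PropositionalEquality using (_≡_; refl; sym; cong; cong₂)
open import Function.Definitions using (Injective)

record Graph : Set where
  field
    n      : ℕ
    adj    : Fin n → Fin n → Bool
    adj-sym    : ∀ i j → adj i j ≡ adj j i
    adj-irrefl : ∀ i → adj i i ≡ false
open Graph public

∑ : ∀ n → (Fin n → ℕ) → ℕ
∑ zero    f = 0
∑ (suc n) f = f Fin.zero + ∑ n (λ i → f (Fin.suc i))
  where import Data.Fin as Fin

ind : Bool → ℕ
ind true  = 1
ind false = 0

edges : Graph → ℕ
edges G = ∑ (n G) (λ i → ∑ (n G) (λ j → ind ((toℕ i <ᵇ toℕ j) ∧ adj G i j)))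

degree : (G : Graph) → Fin (n G) → ℕ
degree G v = ∑ (n G) (λ j → ind (adj G v j))

MaxDeg≤ : Graph → ℕ → Set
MaxDeg≤ G Δ = ∀ v → degree G v ≤ Δ

-- number of copies of K_t: number of t-element vertex sets that are
-- pairwise adjacent, counted by the standard recursion over the list of
-- candidate vertices (each set is counted once, via its first vertex).
cliquesIn : (G : Graph) → ℕ → List (Fin (n G)) → ℕ
cliquesIn G zero    vs       = 1
cliquesIn G (suc t) []       = 0
cliquesIn G (suc t) (v ∷ vs) =
  cliquesIn G (suc t) vs + cliquesIn G t (filter (λ w → adj G v w Data.Bool.≟ true) vs)
  where import Data.Bool

k : ℕ → Graph → ℕ
k t G = cliquesIn G t (allFin (n G))

ContainsK : ℕ → Graph → Set
ContainsK r G = Σ (Fin r → Fin (n G)) λ f →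
  Injective _≡_ _≡_ f × (∀ i j → ¬ i ≡ j → adj G (f i) (f j) ≡ true)

record Iso (G H : Graph) : Set where
  field
    to      : Fin (n G) → Fin (n H)
    from    : Fin (n H) → Fin (n G)
    from-to : ∀ i → from (to i) ≡ i
    to-from : ∀ j → to (from j) ≡ j
    pres    : ∀ i j → adj H (to i) (to j) ≡ adj G i j

pad : Graph → ℕ → Graph
pad G a = record
  { n = n G + a
  ; adj = A
  ; adj-sym = S
  ; adj-irrefl = I
  }
  where
  A : Fin (n G + a) → Fin (n G + a) → Bool
  A i j with splitAt (n G) i | splitAt (n G) j
  ... | inj₁ x | inj₁ y = adj G x y
  ... | _      | _      = false
  S : ∀ i j → A i j ≡ A j i
  S i j with splitAt (n G) i | splitAt (n G) j
  ... | inj₁ x | inj₁ y = adj-sym G x y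
  ... | inj₁ x | inj₂ y = refl
  ... | inj₂ x | inj₁ y = refl
  ... | inj₂ x | inj₂ y = refl
  I : ∀ i → A i i ≡ false
  I i with splitAt (n G) i
  ... | inj₁ x = adj-irrefl G x
  ... | inj₂ x = refl

-- graphs are identified if isomorphic after deleting isolated vertices;
-- equivalently, if they become isomorphic after adding isolated vertices.
_≅_ : Graph → Graph → Set
G ≅ H = Σ ℕ λ a → Σ ℕ λ b → Iso (pad G a) (pad H b)

emptyGraph : Graph
emptyGraph = record { n = 0 ; adj = λ () ; adj-sym = λ () ; adj-irrefl = λ () }

_∪_ : Graph → Graph → Graph
G ∪ H = record { n = n G + n H ; adj = A ; adj-sym = S ; adj-irrefl = I }
  where
  A : Fin (n G + n H) → Fin (n G + n H) → Bool
  A i j with splitAt (n G) i | splitAt (n G) j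
  ... | inj₁ x | inj₁ y = adj G x y
  ... | inj₂ x | inj₂ y = adj H x y
  ... | _      | _      = false
  S : ∀ i j → A i j ≡ A j i
  S i j with splitAt (n G) i | splitAt (n G) j
  ... | inj₁ x | inj₁ y = adj-sym G x y
  ... | inj₂ x | inj₂ y = adj-sym H x y
  ... | inj₁ x | inj₂ y = refl
  ... | inj₂ x | inj₁ y = refl
  I : ∀ i → A i i ≡ false
  I i with splitAt (n G) i
  ... | inj₁ x = adj-irrefl G x
  ... | inj₂ x = adj-irrefl H x

distinct : ∀ {m} → Fin m → Fin m → Bool
distinct i j = not (does (i ≟ j))

distinct-sym : ∀ {m} (i j : Fin m) → distinct i j ≡ distinct j i
distinct-sym i j with i ≟ j | j ≟ i
... | yes _ | yes _ = refl
... | no _  | no _  = refl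
... | yes p | no q  = ⊥-elim (q (sym p))
... | no q  | yes p = ⊥-elim (q (sym p))

distinct-irr : ∀ {m} (i : Fin m) → distinct i i ≡ false
distinct-irr i with i ≟ i
... | yes _ = refl
... | no q  = ⊥-elim (q refl)

graphOn : (m : ℕ) (P : Fin m → Fin m → Bool) → (∀ i j → P i j ≡ P j i) → Graph
graphOn m P Ps = record
  { n = m
  ; adj = λ i j → distinct i j ∧ P i j
  ; adj-sym = λ i j → cong₂ _∧_ (distinct-sym i j) (Ps i j)
  ; adj-irrefl = λ i → cong (_∧ P i i) (distinct-irr i)
  }

K : ℕ → Graph
K m = graphOn m (λ _ _ → true) (λ _ _ → refl)

copies : ℕ → Graph → Graph
copies zero    G = emptyGraph
copies (suc q) G = G ∪ copies q G

-- colex graph L_m for m = C(r,2) + s with 0 ≤ s < r: vertices 0..r,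
-- a clique on 0..r-1, and the extra vertex r adjacent to 0..s-1.
-- (Two distinct vertices x,y are adjacent iff both are < r, or one is < s.)
colexP : (r s : ℕ) → Fin (suc r) → Fin (suc r) → Bool
colexP r s i j = ((toℕ i <ᵇ r) ∧ (toℕ j <ᵇ r)) ∨ ((toℕ i <ᵇ s) ∨ (toℕ j <ᵇ s))

colexP-sym : ∀ r s i j → colexP r s i j ≡ colexP r s j i
colexP-sym r s i j =
  cong₂ _∨_ (∧-comm (toℕ i <ᵇ r) (toℕ j <ᵇ r)) (∨-comm (toℕ i <ᵇ s) (toℕ j <ᵇ s))

L : ℕ → ℕ → Graph
L r s = graphOn (suc r) (colexP r s) (colexP-sym r s)

-- The family 𝓛_{t,Δ}(m) for m = C(r,2) + s, 0 ≤ s < r (and m ≤ C(Δ+1,2)).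
-- (m = 0 corresponds to r = 1, s = 0, where every clause below yields
-- exactly the graphs isomorphic to the empty graph = L_0.)

InFamily : (t Δ r s : ℕ) → Graph → Set
InFamily t Δ r s H =
    (t ∸ 1 ≤ s × H ≅ L r s)
  ⊎ (t ≤ r × s < t ∸ 1 ×
       (H ≅ L r s ⊎ (edges H ≡ r C 2 + s × MaxDeg≤ H Δ × ContainsK r H)))
  ⊎ (r < t ×
       (H ≅ L r s ⊎ (edges H ≡ r C 2 + s × MaxDeg≤ H Δ)))

record MinimumCounterexample (t Δ : ℕ) (G : Graph) (q r s : ℕ) : Set where
  field
    maxdeg : MaxDeg≤ G Δ
    q≥1    : 1 ≤ q
    s<r    : s < r
    r≤Δ    : r ≤ Δ
    size   : edges G ≡ q * (suc Δ C 2) + (r C 2 + s)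
    many   : q * (suc Δ C t) + r C t + s C (t ∸ 1) ≤ k t G
    notExt : ¬ (Σ Graph λ H → InFamily t Δ r s H × G ≅ (copies q (K (suc Δ)) ∪ H))
    -- (v)  (b' = C(r',2) + s' with 0 ≤ s' < r' ≤ Δ is the unique
    --       representation of any 0 ≤ b' < C(Δ+1,2))
    minimal : ∀ (G' : Graph) → MaxDeg≤ G' Δ → edges G' < edges G →
              ∀ q' r' s' → s' < r' → r' ≤ Δ →
              edges G' ≡ q' * (suc Δ C 2) + (r' C 2 + s') →
              (k t G' ≤ k t (copies q' (K (suc Δ)) ∪ L r' s'))
              × (k t G' ≡ k t (copies q' (K (suc Δ)) ∪ L r' s') →
                 Σ Graph λ H → InFamily t Δ r' s' H × G' ≅ (copies q' (K (suc Δ)) ∪ H))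
    maximal : ∀ (G' : Graph) → MaxDeg≤ G' Δ → edges G' ≡ edges G → k t G' ≤ k t G

module Submission where

-- Since s < r, only r = 1 (and hence s = 0) has to be excluded. Then G has q·C(Δ+1,2) edges and at
-- least q·C(Δ+1,t) copies of K_t. Delete a vertex v of degree d ≥ 1: minimality bounds k_t(G − v), so
-- at least C(Δ,t−1) − C(Δ−d,t−1) cliques pass through v, while there are at most C(d,t−1) of them.
-- Strict superadditivity of C(·,t−1) forces d = Δ and makes N(v) a clique, so v and N(v) span a
-- K_{Δ+1}, which is a component because all degrees are at most Δ. The rest of G has exactly
-- (q − 1)·C(Δ+1,2) edges and at least (q − 1)·C(Δ+1,t) copies of K_t, so by minimality it is
-- (q − 1)K_{Δ+1} ∪ H with H in the family; then G ≅ qK_{Δ+1} ∪ H, contradicting (iv).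

open import Defs
open import Data.Nat
open import Data.Nat.Properties
open import Data.Nat.Combinatorics using (_C_; nCk+nC[k+1]≡[n+1]C[k+1]; nC1≡n)
open import Data.Nat.Combinatorics.Specification using (k>n⇒nCk≡0)
open import Data.Nat.ListAction using (sum)
open import Data.Nat.ListAction.Properties using (sum-++; sum-↭)
import Data.Bool.Properties as BoolP
open import Data.Bool as Bool using (Bool; true; false; not; _∧_; _∨_)
open import Data.Fin as Fin using (Fin; zero; suc; toℕ; _↑ˡ_; _↑ʳ_; splitAt)
import Data.Fin.Properties as FinP
open import Data.List using (List; []; _∷_; _++_; map; filter; length; tabulate; allFin)
open import Data.List.Properties
  using (map-tabulate; map-++; ++-identityʳ; length-tabulate; length-filter;
         filter-accept; filter-reject; filter-all; filter-none; filter-++; filter-complete)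
open import Data.List.Relation.Unary.All using (All; []; _∷_)
import Data.List.Relation.Unary.All as All
open import Data.List.Relation.Unary.Any using (here; there)
open import Data.List.Membership.Propositional using (_∈_)
open import Data.List.Membership.Propositional.Properties using (∈-tabulate⁺; ∈-filter⁺)
open import Data.List.Relation.Unary.All.Properties using (all-filter; tabulate⁺)
open import Data.List.Relation.Unary.AllPairs using (AllPairs; []; _∷_)
import Data.List.Relation.Unary.AllPairs as AllPairs
open import Data.List.Relation.Unary.Unique.Propositional.Properties using (allFin⁺)
open import Data.List.Relation.Binary.Permutation.Propositional as ↭ using (_↭_; prep; swap; ↭-refl; ↭-sym; ↭-trans)
open import Data.List.Relation.Binary.Permutation.Propositional.Properties using (map⁺; shift; filter-↭)
open import Data.Product using (Σ; ∃; _×_; _,_; proj₁; proj₂)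
open import Data.Sum as Sum using (_⊎_; inj₁; inj₂)
open import Data.Sum.Algebra using (⊎-assoc)
open import Data.Sum.Function.Propositional using (_⊎-↔_)
open import Function.Bundles using (_↔_; Inverse; mk↔ₛ′)
open import Function.Properties.Inverse using (↔-refl; ↔-trans)
open import Data.Empty using (⊥-elim)
open import Relation.Nullary using (¬_; Dec; yes; no; does; contradiction)
open import Relation.Nullary.Decidable using (dec-true; dec-false)
open import Relation.Binary.PropositionalEquality hiding ([_])
open import Relation.Binary.Definitions using (tri<; tri≈; tri>)
open import Function using (_∘_; id; case_of_)
open import Data.Nat.Tactic.RingSolver using (solve-∀)

-- Binomial coefficients

C-suc : ∀ n k → suc n C suc k ≡ n C k + n C suc k
C-suc n k = sym (nCk+nC[k+1]≡[n+1]C[k+1] n k)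

C-suc′ : ∀ n k → suc n C suc k ≡ n C suc k + n C k
C-suc′ n k = trans (C-suc n k) (+-comm (n C k) _)

C-monoˡ-≤ : ∀ {m n} k → m ≤ n → m C k ≤ n C k
C-monoˡ-≤ zero    _         = ≤-refl
C-monoˡ-≤ {n = n} (suc k) z≤n =
  subst (_≤ n C suc k) (sym (k>n⇒nCk≡0 {0} {suc k} (s≤s z≤n))) z≤n
C-monoˡ-≤ {suc m} {suc n} (suc k) (s≤s m≤n) rewrite C-suc m k | C-suc n k =
  +-mono-≤ (C-monoˡ-≤ k m≤n) (C-monoˡ-≤ (suc k) m≤n)

C-pos : ∀ {n k} → k ≤ n → 0 < n C k
C-pos {n}     {zero}  _         = s≤s z≤n
C-pos {suc n} {suc k} (s≤s k≤n) rewrite C-suc n k = ≤-trans (C-pos k≤n) (m≤m+n (n C k) _)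

C-monoˡ-< : ∀ {m n k} → m < n → 1 ≤ k → k ≤ n → m C k < n C k
C-monoˡ-< {m} {suc n} {suc k} (s≤s m≤n) _ (s≤s k≤n) = begin-strict
  m C suc k                ≤⟨ C-monoˡ-≤ (suc k) m≤n ⟩
  n C suc k                <⟨ m<n+m (n C suc k) (C-pos k≤n) ⟩
  n C k + n C suc k        ≡⟨ C-suc n k ⟨
  suc n C suc k            ∎
  where open ≤-Reasoning

private
  C-sum-suc : ∀ a b k → a C suc k + suc b C suc k ≡ (a C suc k + b C suc k) + b C k
  C-sum-suc a b k = trans (cong (a C suc k +_) (C-suc′ b k)) (sym (+-assoc (a C suc k) _ _))

  C-+-suc : ∀ a b k → (a + suc b) C suc k ≡ (a + b) C suc k + (a + b) C k
  C-+-suc a b k = trans (cong (_C suc k) (+-suc a b)) (C-suc′ (a + b) k)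

C-superadditive : ∀ a b k → a C suc k + b C suc k ≤ (a + b) C suc k
C-superadditive a zero    k rewrite +-identityʳ a | +-identityʳ (a C suc k) = ≤-refl
C-superadditive a (suc b) k rewrite C-sum-suc a b k | C-+-suc a b k =
  +-mono-≤ (C-superadditive a b k) (C-monoˡ-≤ k (m≤n+m b a))

C-superadditive-< : ∀ {a b k} → 1 ≤ a → 1 ≤ b → 2 ≤ k → k ≤ a + b → a C k + b C k < (a + b) C k
C-superadditive-< {a} {suc b} {suc k} 1≤a _ (s≤s 1≤k) k<a+b rewrite C-sum-suc a b k | C-+-suc a b k =
  +-mono-≤-< (C-superadditive a b k) (C-monoˡ-< (m<n+m b 1≤a) 1≤k k≤a+b)
  where
  k≤a+b : k ≤ a + b
  k≤a+b = ≤-pred (subst (suc k ≤_) (+-suc a b) k<a+b)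

∑-cong : ∀ n {f g : Fin n → ℕ} → (∀ i → f i ≡ g i) → ∑ n f ≡ ∑ n g
∑-cong zero    _ = refl
∑-cong (suc n) h = cong₂ _+_ (h zero) (∑-cong n (h ∘ suc))

∑-+ : ∀ n (f g : Fin n → ℕ) → ∑ n (λ i → f i + g i) ≡ ∑ n f + ∑ n g
∑-+ zero    f g = refl
∑-+ (suc n) f g rewrite ∑-+ n (f ∘ suc) (g ∘ suc) = +-exch (f zero) (g zero) _ _
  where
  +-exch : ∀ a b c d → a + b + (c + d) ≡ a + c + (b + d)
  +-exch = solve-∀

∑-const : ∀ n c → ∑ n (λ _ → c) ≡ n * c
∑-const zero    c = refl
∑-const (suc n) c = cong (c +_) (∑-const n c)

∑-one : ∀ n → ∑ n (λ _ → 1) ≡ n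
∑-one n = trans (∑-const n 1) (*-identityʳ n)

∑-zero : ∀ n → ∑ n (λ _ → 0) ≡ 0
∑-zero n = trans (∑-const n 0) (*-zeroʳ n)

∑-swap : ∀ n m (f : Fin n → Fin m → ℕ) → ∑ n (λ i → ∑ m (f i)) ≡ ∑ m (λ j → ∑ n (λ i → f i j))
∑-swap zero    m f = sym (∑-zero m)
∑-swap (suc n) m f rewrite ∑-swap n m (f ∘ suc) = sym (∑-+ m (f zero) _)

∑-point : ∀ n (f : Fin n → ℕ) v → (∀ j → j ≢ v → f j ≡ 0) → ∑ n f ≡ f v
∑-point (suc n) f zero h =
  trans (cong (f zero +_) (trans (∑-cong n (λ j → h (suc j) λ ())) (∑-zero n))) (+-identityʳ _)
∑-point (suc n) f (suc v) h =
  cong₂ _+_ (h zero λ ()) (∑-point n (f ∘ suc) v (λ j j≢v → h (suc j) (j≢v ∘ FinP.suc-injective)))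

∑≡0 : ∀ n (f : Fin n → ℕ) → ∑ n f ≡ 0 → ∀ i → f i ≡ 0
∑≡0 (suc n) f e zero    = m+n≡0⇒m≡0 (f zero) e
∑≡0 (suc n) f e (suc i) = ∑≡0 n (f ∘ suc) (m+n≡0⇒n≡0 (f zero) e) i

∑-pos : ∀ n (f : Fin n → ℕ) → 0 < ∑ n f → ∃ λ i → 0 < f i
∑-pos (suc n) f h with f zero in eq
... | suc _ = zero , subst (0 <_) (sym eq) (s≤s z≤n)
... | zero  = let i , fi>0 = ∑-pos n (f ∘ suc) h in suc i , fi>0

∑≡sum-tabulate : ∀ n (f : Fin n → ℕ) → ∑ n f ≡ sum (tabulate f)
∑≡sum-tabulate zero    f = refl
∑≡sum-tabulate (suc n) f = cong (f zero +_) (∑≡sum-tabulate n (f ∘ suc))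

-- Enumerating the elements of Fin n that satisfy a predicate

bump : Bool → ℕ → ℕ
bump true  c = suc c
bump false c = c

count : ∀ {n} → (Fin n → Bool) → ℕ
count {zero}  p = 0
count {suc n} p = bump (p zero) (count (p ∘ suc))

extend : ∀ {c n} b → (Fin c → Fin n) → Fin (bump b c) → Fin (suc n)
extend true  f zero    = zero
extend true  f (suc i) = suc (f i)
extend false f i       = suc (f i)

select : ∀ {n} (p : Fin n → Bool) → Fin (count p) → Fin n
select {suc n} p = extend (p zero) (select (p ∘ suc))

select-sound : ∀ {n} (p : Fin n → Bool) i → p (select p i) ≡ true
select-sound {suc n} p i with p zero in eq
select-sound {suc n} p zero    | true = eq
select-sound {suc n} p (suc i) | true = select-sound (p ∘ suc) i
select-sound {suc n} p i       | false = select-sound (p ∘ suc) i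

select-injective : ∀ {n} (p : Fin n → Bool) {i j} → select p i ≡ select p j → i ≡ j
select-injective {suc n} p {i} {j} e with p zero
select-injective {suc n} p {zero}  {zero}  e | true = refl
select-injective {suc n} p {suc i} {suc j} e | true =
  cong suc (select-injective (p ∘ suc) (FinP.suc-injective e))
select-injective {suc n} p {i}     {j}     e | false =
  select-injective (p ∘ suc) (FinP.suc-injective e)

select-complete : ∀ {n} (p : Fin n → Bool) u → p u ≡ true → ∃ λ j → select p j ≡ u
select-complete {suc n} p u pu with p zero in eq
select-complete {suc n} p zero    pu | true  = zero , refl
select-complete {suc n} p zero    pu | false = case trans (sym eq) pu of λ ()
select-complete {suc n} p (suc u) pu | true  =
  let j , e = select-complete (p ∘ suc) u pu in suc j , cong suc e
select-complete {suc n} p (suc u) pu | false =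
  let j , e = select-complete (p ∘ suc) u pu in j , cong suc e

count≡∑ : ∀ {n} (p : Fin n → Bool) → count p ≡ ∑ n (ind ∘ p)
count≡∑ {zero}  p = refl
count≡∑ {suc n} p with p zero
... | true  = cong suc (count≡∑ (p ∘ suc))
... | false = count≡∑ (p ∘ suc)

allFin-↭-select : ∀ n (p : Fin n → Bool) →
  allFin n ↭ tabulate (select p) ++ tabulate (select (not ∘ p))
allFin-↭-select zero    p = ↭-refl
allFin-↭-select (suc n) p = ↭-trans (prep zero tail↭) (head-placed (p zero))
  where
  T = tabulate (λ i → suc (select (p ∘ suc) i))
  F = tabulate (λ i → suc (select (not ∘ p ∘ suc) i))
  tail↭ : tabulate {n = n} suc ↭ T ++ F
  tail↭ = subst₂ _↭_ (map-tabulate id suc)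
            (trans (map-++ suc (tabulate (select (p ∘ suc))) (tabulate (select (not ∘ p ∘ suc))))
                   (cong₂ _++_ (map-tabulate (select (p ∘ suc)) suc) (map-tabulate (select (not ∘ p ∘ suc)) suc)))
            (map⁺ suc (allFin-↭-select n (p ∘ suc)))
  head-placed : ∀ b → zero ∷ T ++ F ↭ tabulate (extend b (select (p ∘ suc)))
                                      ++ tabulate (extend (not b) (select (not ∘ p ∘ suc)))
  head-placed true  = ↭-refl
  head-placed false = ↭-sym (shift zero T F)

∑-select : ∀ n (p : Fin n → Bool) (f : Fin n → ℕ) →
  ∑ n f ≡ ∑ (count p) (f ∘ select p) + ∑ (count (not ∘ p)) (f ∘ select (not ∘ p))
∑-select n p f = begin
  ∑ n f                                               ≡⟨ ∑≡sum-tabulate n f ⟩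
  sum (tabulate f)                                    ≡⟨ cong sum (map-tabulate id f) ⟨
  sum (map f (allFin n))                              ≡⟨ sum-↭ (map⁺ f (allFin-↭-select n p)) ⟩
  sum (map f (tabulate (select p) ++ tabulate (select (not ∘ p))))
                                                      ≡⟨ cong sum (map-++ f (tabulate (select p)) _) ⟩
  sum (map f (tabulate (select p)) ++ map f (tabulate (select (not ∘ p))))
                                                      ≡⟨ sum-++ (map f (tabulate (select p))) _ ⟩
  sum (map f (tabulate (select p))) + sum (map f (tabulate (select (not ∘ p))))
                                                      ≡⟨ cong₂ _+_ (sum-map p) (sum-map (not ∘ p)) ⟩
  ∑ (count p) (f ∘ select p) + ∑ (count (not ∘ p)) (f ∘ select (not ∘ p)) ∎
  where
  open ≡-Reasoning
  sum-map : ∀ q → sum (map f (tabulate (select q))) ≡ ∑ (count q) (f ∘ select q)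
  sum-map q = trans (cong sum (map-tabulate (select q) f)) (sym (∑≡sum-tabulate _ (f ∘ select q)))

select-disjoint : ∀ {m} (p : Fin m → Bool) i j → select p i ≢ select (not ∘ p) j
select-disjoint p i j e with select-sound p i | select-sound (not ∘ p) j
... | sound | sound′ rewrite e | sound = case sound′ of λ ()

select-↔ : ∀ {m} (p : Fin m → Bool) → Fin m ↔ (Fin (count p) ⊎ Fin (count (not ∘ p)))
select-↔ {m} p = mk↔ₛ′ locate inject locate-inject inject-locate
  where
  inject : Fin (count p) ⊎ Fin (count (not ∘ p)) → Fin m
  inject = Sum.[ select p , select (not ∘ p) ]
  classify : ∀ u → (∃ λ i → select p i ≡ u) ⊎ (∃ λ j → select (not ∘ p) j ≡ u)
  classify u with p u in pu
  ... | true  = inj₁ (select-complete p u pu)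
  ... | false = inj₂ (select-complete (not ∘ p) u (cong not pu))
  locate : Fin m → Fin (count p) ⊎ Fin (count (not ∘ p))
  locate = Sum.map proj₁ proj₁ ∘ classify
  inject-locate : ∀ u → inject (locate u) ≡ u
  inject-locate u with classify u
  ... | inj₁ (i , e) = e
  ... | inj₂ (j , e) = e
  locate-inject : ∀ s → locate (inject s) ≡ s
  locate-inject (inj₁ i) with classify (select p i)
  ... | inj₁ (i′ , e) = cong inj₁ (select-injective p e)
  ... | inj₂ (j′ , e) = ⊥-elim (select-disjoint p i j′ (sym e))
  locate-inject (inj₂ j) with classify (select (not ∘ p) j)
  ... | inj₁ (i′ , e) = ⊥-elim (select-disjoint p i′ j e)
  ... | inj₂ (j′ , e) = cong inj₂ (select-injective (not ∘ p) e)

-- Counting cliques in a list of vertices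

AllPairs-short : ∀ {a ℓ} {A : Set a} {R : A → A → Set ℓ} xs → length xs ≤ 1 → AllPairs R xs
AllPairs-short []          _             = []
AllPairs-short (x ∷ [])    _             = [] ∷ []
AllPairs-short (x ∷ y ∷ _) (s≤s ())

AllPairs-∈ : ∀ {a ℓ} {A : Set a} {R : A → A → Set ℓ} → (∀ {x y} → R x y → R y x) →
             ∀ {xs x y} → AllPairs R xs → x ∈ xs → y ∈ xs → x ≢ y → R x y
AllPairs-∈ R-sym (Rx ∷ _)  (here refl) (here refl) x≢y = ⊥-elim (x≢y refl)
AllPairs-∈ R-sym (Rx ∷ _)  (here refl) (there y∈) _   = All.lookup Rx y∈
AllPairs-∈ R-sym (Rx ∷ _)  (there x∈)  (here refl) _   = R-sym (All.lookup Rx x∈)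
AllPairs-∈ R-sym (_ ∷ Rxs) (there x∈)  (there y∈) x≢y = AllPairs-∈ R-sym Rxs x∈ y∈ x≢y

module _ (G : Graph) where

  Adjacent : Fin (n G) → Fin (n G) → Set
  Adjacent x y = adj G x y ≡ true

  adjacent? : ∀ v w → Dec (Adjacent v w)
  adjacent? v w = adj G v w Bool.≟ true

  neighbours : Fin (n G) → List (Fin (n G)) → List (Fin (n G))
  neighbours v = filter (adjacent? v)

  neighbours-accept : ∀ {v x} xs → adj G v x ≡ true → neighbours v (x ∷ xs) ≡ x ∷ neighbours v xs
  neighbours-accept xs e = filter-accept (adjacent? _) e

  neighbours-reject : ∀ {v x} xs → adj G v x ≡ false → neighbours v (x ∷ xs) ≡ neighbours v xs
  neighbours-reject xs e = filter-reject (adjacent? _) λ e′ → case trans (sym e) e′ of λ ()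

  neighbours-comm : ∀ a b xs → neighbours a (neighbours b xs) ≡ neighbours b (neighbours a xs)
  neighbours-comm a b [] = refl
  neighbours-comm a b (x ∷ xs) = by-cases (adj G a x) refl (adj G b x) refl
    where
    by-cases : ∀ α → adj G a x ≡ α → ∀ β → adj G b x ≡ β →
               neighbours a (neighbours b (x ∷ xs)) ≡ neighbours b (neighbours a (x ∷ xs))
    by-cases true ea true eb
      rewrite neighbours-accept xs eb | neighbours-accept (neighbours b xs) ea
            | neighbours-accept xs ea | neighbours-accept (neighbours a xs) eb
      = cong (x ∷_) (neighbours-comm a b xs)
    by-cases true ea false eb
      rewrite neighbours-reject xs eb | neighbours-accept xs ea | neighbours-reject (neighbours a xs) eb
      = neighbours-comm a b xs
    by-cases false ea true eb
      rewrite neighbours-accept xs eb | neighbours-reject (neighbours b xs) ea | neighbours-reject xs ea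
      = neighbours-comm a b xs
    by-cases false ea false eb
      rewrite neighbours-reject xs eb | neighbours-reject xs ea
      = neighbours-comm a b xs

  neighbours-↭ : ∀ v {xs ys} → xs ↭ ys → neighbours v xs ↭ neighbours v ys
  neighbours-↭ v = filter-↭ (adjacent? v)

  cliquesIn-swap : ∀ t x y xs ys →
    cliquesIn G (suc (suc t)) xs ≡ cliquesIn G (suc (suc t)) ys →
    cliquesIn G (suc t) (neighbours x xs) ≡ cliquesIn G (suc t) (neighbours x ys) →
    cliquesIn G (suc t) (neighbours y xs) ≡ cliquesIn G (suc t) (neighbours y ys) →
    cliquesIn G t (neighbours y (neighbours x xs)) ≡ cliquesIn G t (neighbours x (neighbours y ys)) →
    cliquesIn G (suc (suc t)) (x ∷ y ∷ xs) ≡ cliquesIn G (suc (suc t)) (y ∷ x ∷ ys)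
  cliquesIn-swap t x y xs ys e₀ eˣ eʸ eˣʸ = by-cases (adj G x y) refl
    where
    by-cases : ∀ α → adj G x y ≡ α →
               cliquesIn G (suc (suc t)) (x ∷ y ∷ xs) ≡ cliquesIn G (suc (suc t)) (y ∷ x ∷ ys)
    by-cases true e
      rewrite neighbours-accept xs e | neighbours-accept ys (trans (adj-sym G y x) e) | e₀ | eˣ | eʸ | eˣʸ
      = +-exch (cliquesIn G (suc (suc t)) ys) (cliquesIn G (suc t) (neighbours y ys))
               (cliquesIn G (suc t) (neighbours x ys)) (cliquesIn G t (neighbours x (neighbours y ys)))
      where
      +-exch : ∀ a b c d → a + b + (c + d) ≡ a + c + (b + d)
      +-exch = solve-∀
    by-cases false e
      rewrite neighbours-reject xs e | neighbours-reject ys (trans (adj-sym G y x) e) | e₀ | eˣ | eʸ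
      = +-exch (cliquesIn G (suc (suc t)) ys) (cliquesIn G (suc t) (neighbours y ys))
               (cliquesIn G (suc t) (neighbours x ys))
      where
      +-exch : ∀ a b c → a + b + c ≡ a + c + b
      +-exch = solve-∀

  cliquesIn-↭ : ∀ t {xs ys} → xs ↭ ys → cliquesIn G t xs ≡ cliquesIn G t ys
  cliquesIn-↭ zero          _                 = refl
  cliquesIn-↭ (suc t)       ↭.refl            = refl
  cliquesIn-↭ (suc t)       (prep x p)        =
    cong₂ _+_ (cliquesIn-↭ (suc t) p) (cliquesIn-↭ t (neighbours-↭ x p))
  cliquesIn-↭ (suc t)       (↭.trans p q)     = trans (cliquesIn-↭ (suc t) p) (cliquesIn-↭ (suc t) q)
  cliquesIn-↭ (suc zero)    (swap x y p)      = cong (λ c → c + 1 + 1) (cliquesIn-↭ 1 p)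
  cliquesIn-↭ (suc (suc t)) (swap {xs} {ys} x y p) =
    cliquesIn-swap t x y xs ys (cliquesIn-↭ (suc (suc t)) p)
      (cliquesIn-↭ (suc t) (neighbours-↭ x p)) (cliquesIn-↭ (suc t) (neighbours-↭ y p))
      (trans (cliquesIn-↭ t (neighbours-↭ y (neighbours-↭ x p))) (cong (cliquesIn G t) (neighbours-comm y x ys)))

  length-neighbours : ∀ v xs → length (neighbours v xs) ≤ length xs
  length-neighbours v = length-filter (adjacent? v)

  cliquesIn-≤ : ∀ t xs → cliquesIn G t xs ≤ length xs C t
  cliquesIn-≤ zero    xs       = ≤-refl
  cliquesIn-≤ (suc t) []       = z≤n
  cliquesIn-≤ (suc t) (x ∷ xs) = begin
    cliquesIn G (suc t) xs + cliquesIn G t (neighbours x xs)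
      ≤⟨ +-mono-≤ (cliquesIn-≤ (suc t) xs) (cliquesIn-≤ t (neighbours x xs)) ⟩
    length xs C suc t + length (neighbours x xs) C t
      ≤⟨ +-monoʳ-≤ (length xs C suc t) (C-monoˡ-≤ t (length-neighbours x xs)) ⟩
    length xs C suc t + length xs C t
      ≡⟨ C-suc′ (length xs) t ⟨
    suc (length xs) C suc t ∎
    where open ≤-Reasoning

  cliquesIn-clique : ∀ t xs → AllPairs Adjacent xs → cliquesIn G t xs ≡ length xs C t
  cliquesIn-clique zero    xs       _          = refl
  cliquesIn-clique (suc t) []       _          = refl
  cliquesIn-clique (suc t) (x ∷ xs) (x~ ∷ xs~) = begin
    cliquesIn G (suc t) xs + cliquesIn G t (neighbours x xs)
      ≡⟨ cong (λ ys → cliquesIn G (suc t) xs + cliquesIn G t ys) (filter-all (adjacent? x) x~) ⟩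
    cliquesIn G (suc t) xs + cliquesIn G t xs
      ≡⟨ cong₂ _+_ (cliquesIn-clique (suc t) xs xs~) (cliquesIn-clique t xs xs~) ⟩
    length xs C suc t + length xs C t
      ≡⟨ C-suc′ (length xs) t ⟨
    suc (length xs) C suc t ∎
    where open ≡-Reasoning

  cliquesIn-++ : ∀ t xs ys → All (λ x → All (¬_ ∘ Adjacent x) ys) xs →
                 cliquesIn G (suc t) (xs ++ ys) ≡ cliquesIn G (suc t) xs + cliquesIn G (suc t) ys
  cliquesIn-++ t []       ys _            = refl
  cliquesIn-++ t (x ∷ xs) ys (x≁ys ∷ xs≁ys) = begin
    cliquesIn G (suc t) (xs ++ ys) + cliquesIn G t (neighbours x (xs ++ ys))
      ≡⟨ cong₂ _+_ (cliquesIn-++ t xs ys xs≁ys) (cong (cliquesIn G t) neighbours-++) ⟩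
    cliquesIn G (suc t) xs + cliquesIn G (suc t) ys + cliquesIn G t (neighbours x xs)
      ≡⟨ +-exch (cliquesIn G (suc t) xs) (cliquesIn G (suc t) ys) _ ⟩
    cliquesIn G (suc t) xs + cliquesIn G t (neighbours x xs) + cliquesIn G (suc t) ys ∎
    where
    open ≡-Reasoning
    neighbours-++ : neighbours x (xs ++ ys) ≡ neighbours x xs
    neighbours-++ = begin
      neighbours x (xs ++ ys)             ≡⟨ filter-++ (adjacent? x) xs ys ⟩
      neighbours x xs ++ neighbours x ys  ≡⟨ cong (neighbours x xs ++_) (filter-none (adjacent? x) x≁ys) ⟩
      neighbours x xs ++ []               ≡⟨ ++-identityʳ _ ⟩
      neighbours x xs                     ∎
    +-exch : ∀ a b c → a + b + c ≡ a + c + b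
    +-exch = solve-∀

  -- Both summands of C(l+1,t) = C(l,t) + C(l,t−1) must be attained: x is adjacent to every vertex
  -- of ys, and ys is again extremal.
  cliquesIn-extremal : ∀ t xs → 2 ≤ t → t ≤ length xs → length xs C t ≤ cliquesIn G t xs →
                       AllPairs Adjacent xs
  cliquesIn-extremal (suc t) (x ∷ ys) (s≤s 1≤t) (s≤s t≤l) h = x~ys ∷ ys-clique
    where
    l = length ys
    N = neighbours x ys
    h′ : l C suc t + l C t ≤ cliquesIn G (suc t) ys + cliquesIn G t N
    h′ = subst (_≤ cliquesIn G (suc t) ys + cliquesIn G t N) (C-suc′ l t) h
    N-tight : l C t ≤ cliquesIn G t N
    N-tight = +-cancelˡ-≤ (l C suc t) _ _ (≤-trans h′ (+-monoˡ-≤ _ (cliquesIn-≤ (suc t) ys)))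
    ys-tight : l C suc t ≤ cliquesIn G (suc t) ys
    ys-tight = +-cancelʳ-≤ (l C t) _ _
      (≤-trans h′ (+-monoʳ-≤ _ (≤-trans (cliquesIn-≤ t N) (C-monoˡ-≤ t (length-neighbours x ys)))))
    |N|≡l : length N ≡ l
    |N|≡l with length N <? l
    ... | yes |N|<l = contradiction (≤-trans N-tight (cliquesIn-≤ t N)) (<⇒≱ (C-monoˡ-< |N|<l 1≤t t≤l))
    ... | no  |N|≮l = ≤-antisym (length-neighbours x ys) (≮⇒≥ |N|≮l)
    N≡ys : N ≡ ys
    N≡ys = filter-complete (adjacent? x) |N|≡l
    x~ys : All (Adjacent x) ys
    x~ys = subst (All (Adjacent x)) N≡ys (all-filter (adjacent? x) ys)
    ys-clique : AllPairs Adjacent ys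
    ys-clique with suc t ≤? l | 2 ≤? t
    ... | yes t<l | _       = cliquesIn-extremal (suc t) ys (s≤s 1≤t) t<l ys-tight
    ... | no  t≮l | yes 2≤t =
      cliquesIn-extremal t ys 2≤t t≤l (subst (λ zs → l C t ≤ cliquesIn G t zs) N≡ys N-tight)
    ... | no  t≮l | no  2≰t = AllPairs-short ys (≤-trans (≮⇒≥ t≮l) (≤-pred (≰⇒> 2≰t)))

  length-neighbours-tabulate : ∀ v {m} (f : Fin m → Fin (n G)) →
    length (neighbours v (tabulate f)) ≡ ∑ m (λ u → ind (adj G v (f u)))
  length-neighbours-tabulate v {zero}  f = refl
  length-neighbours-tabulate v {suc m} f = by-cases (adj G v (f zero)) refl
    where
    by-cases : ∀ α → adj G v (f zero) ≡ α →
               length (neighbours v (tabulate f)) ≡ ∑ (suc m) (λ u → ind (adj G v (f u)))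
    by-cases true  e rewrite neighbours-accept (tabulate (f ∘ suc)) e | e =
      cong suc (length-neighbours-tabulate v (f ∘ suc))
    by-cases false e rewrite neighbours-reject (tabulate (f ∘ suc)) e | e =
      length-neighbours-tabulate v (f ∘ suc)

module _ (H G : Graph) (e : Fin (n H) → Fin (n G)) (e-pres : ∀ i j → adj G (e i) (e j) ≡ adj H i j) where

  map-neighbours : ∀ x xs → map e (neighbours H x xs) ≡ neighbours G (e x) (map e xs)
  map-neighbours x []       = refl
  map-neighbours x (y ∷ ys) = by-cases (adj H x y) refl
    where
    by-cases : ∀ α → adj H x y ≡ α → map e (neighbours H x (y ∷ ys)) ≡ neighbours G (e x) (map e (y ∷ ys))
    by-cases true  x~y rewrite neighbours-accept H ys x~y | neighbours-accept G (map e ys) (trans (e-pres x y) x~y) =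
      cong (e y ∷_) (map-neighbours x ys)
    by-cases false x≁y rewrite neighbours-reject H ys x≁y | neighbours-reject G (map e ys) (trans (e-pres x y) x≁y) =
      map-neighbours x ys

  cliquesIn-map : ∀ t xs → cliquesIn H t xs ≡ cliquesIn G t (map e xs)
  cliquesIn-map zero    xs       = refl
  cliquesIn-map (suc t) []       = refl
  cliquesIn-map (suc t) (x ∷ xs) =
    cong₂ _+_ (cliquesIn-map (suc t) xs)
              (trans (cliquesIn-map t (neighbours H x xs)) (cong (cliquesIn G t) (map-neighbours x xs)))

ind≡0 : ∀ {b} → ind b ≡ 0 → b ≡ false
ind≡0 {false} _ = refl

private
  <ᵇ-true : ∀ {m n} → m < n → (m <ᵇ n) ≡ true
  <ᵇ-true {zero}  {suc n} _         = refl
  <ᵇ-true {suc m} {suc n} (s≤s m<n) = <ᵇ-true m<n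

  <ᵇ-false : ∀ {m n} → n ≤ m → (m <ᵇ n) ≡ false
  <ᵇ-false {m}     {zero}  _         = refl
  <ᵇ-false {suc m} {suc n} (s≤s n≤m) = <ᵇ-false n≤m

-- Every edge {i, j} is counted by edges G once, at its smaller endpoint.
ind-adj-split : ∀ G (i j : Fin (n G)) →
  ind (adj G i j) ≡ ind ((toℕ i <ᵇ toℕ j) ∧ adj G i j) + ind ((toℕ j <ᵇ toℕ i) ∧ adj G j i)
ind-adj-split G i j with <-cmp (toℕ i) (toℕ j)
... | tri< i<j _ _ rewrite <ᵇ-true i<j | <ᵇ-false (<⇒≤ i<j) = sym (+-identityʳ _)
... | tri> _ _ j<i rewrite <ᵇ-true j<i | <ᵇ-false (<⇒≤ j<i) | adj-sym G j i = refl
... | tri≈ _ i≡j _ rewrite FinP.toℕ-injective i≡j | adj-irrefl G j | BoolP.∧-zeroʳ (toℕ j <ᵇ toℕ j) = refl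

handshake : ∀ G → 2 * edges G ≡ ∑ (n G) (degree G)
handshake G = sym (begin
  ∑ m (degree G)                                   ≡⟨ ∑-cong m (λ i → ∑-cong m (ind-adj-split G i)) ⟩
  ∑ m (λ i → ∑ m (λ j → f i j + f j i))            ≡⟨ ∑-cong m (λ i → ∑-+ m (f i) (λ j → f j i)) ⟩
  ∑ m (λ i → ∑ m (f i) + ∑ m (λ j → f j i))        ≡⟨ ∑-+ m (λ i → ∑ m (f i)) _ ⟩
  edges G + ∑ m (λ i → ∑ m (λ j → f j i))          ≡⟨ cong (edges G +_) (∑-swap m m f) ⟨
  edges G + edges G                                ≡⟨ cong (edges G +_) (+-identityʳ (edges G)) ⟨
  2 * edges G                                      ∎)
  where
  open ≡-Reasoning
  m = n G
  f : Fin m → Fin m → ℕ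
  f i j = ind ((toℕ i <ᵇ toℕ j) ∧ adj G i j)

k-≤ : ∀ t G → k t G ≤ n G C t
k-≤ t G = subst (λ m → k t G ≤ m C t) (length-tabulate id) (cliquesIn-≤ G t (allFin (n G)))

k-embedding : ∀ t H G (e : Fin (n H) → Fin (n G)) → (∀ i j → adj G (e i) (e j) ≡ adj H i j) →
              k t H ≡ cliquesIn G t (tabulate e)
k-embedding t H G e e-pres = trans (cliquesIn-map H G e e-pres t (allFin (n H)))
                                   (cong (cliquesIn G t) (map-tabulate id e))

-- Disjoint unions and isomorphisms

_⊕_ : ∀ {X Y : Set} → (X → X → Bool) → (Y → Y → Bool) → X ⊎ Y → X ⊎ Y → Bool
(R ⊕ S) (inj₁ x) (inj₁ x′) = R x x′
(R ⊕ S) (inj₂ y) (inj₂ y′) = S y y′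
(R ⊕ S) _        _         = false

adj-∪ : ∀ A B i j → adj (A ∪ B) i j ≡ (adj A ⊕ adj B) (splitAt (n A) i) (splitAt (n A) j)
adj-∪ A B i j with splitAt (n A) i | splitAt (n A) j
... | inj₁ x | inj₁ y = refl
... | inj₁ x | inj₂ y = refl
... | inj₂ x | inj₁ y = refl
... | inj₂ x | inj₂ y = refl

adj-∪-↑ˡ : ∀ A B x y → adj (A ∪ B) (x ↑ˡ n B) (y ↑ˡ n B) ≡ adj A x y
adj-∪-↑ˡ A B x y rewrite adj-∪ A B (x ↑ˡ n B) (y ↑ˡ n B)
                       | FinP.splitAt-↑ˡ (n A) x (n B) | FinP.splitAt-↑ˡ (n A) y (n B) = refl

adj-∪-↑ʳ : ∀ A B x y → adj (A ∪ B) (n A ↑ʳ x) (n A ↑ʳ y) ≡ adj B x y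
adj-∪-↑ʳ A B x y rewrite adj-∪ A B (n A ↑ʳ x) (n A ↑ʳ y)
                       | FinP.splitAt-↑ʳ (n A) (n B) x | FinP.splitAt-↑ʳ (n A) (n B) y = refl

adj-∪-↑ˡ↑ʳ : ∀ A B x y → adj (A ∪ B) (x ↑ˡ n B) (n A ↑ʳ y) ≡ false
adj-∪-↑ˡ↑ʳ A B x y rewrite adj-∪ A B (x ↑ˡ n B) (n A ↑ʳ y)
                         | FinP.splitAt-↑ˡ (n A) x (n B) | FinP.splitAt-↑ʳ (n A) (n B) y = refl

tabulate-+ : ∀ {ℓ} {X : Set ℓ} a b (f : Fin (a + b) → X) →
             tabulate f ≡ tabulate (f ∘ (_↑ˡ b)) ++ tabulate (f ∘ (a ↑ʳ_))
tabulate-+ zero    b f = refl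
tabulate-+ (suc a) b f = cong (f zero ∷_) (tabulate-+ a b (f ∘ suc))

k-∪ : ∀ t A B → k (suc t) (A ∪ B) ≡ k (suc t) A + k (suc t) B
k-∪ t A B = begin
  k (suc t) (A ∪ B)
    ≡⟨ cong (cliquesIn (A ∪ B) (suc t)) (tabulate-+ (n A) (n B) id) ⟩
  cliquesIn (A ∪ B) (suc t) (tabulate (_↑ˡ n B) ++ tabulate (n A ↑ʳ_))
    ≡⟨ cliquesIn-++ (A ∪ B) t _ _ (tabulate⁺ λ x → tabulate⁺ λ y → no-cross x y) ⟩
  cliquesIn (A ∪ B) (suc t) (tabulate (_↑ˡ n B)) + cliquesIn (A ∪ B) (suc t) (tabulate (n A ↑ʳ_))
    ≡⟨ cong₂ _+_ (k-embedding (suc t) A (A ∪ B) (_↑ˡ n B) (adj-∪-↑ˡ A B))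
                 (k-embedding (suc t) B (A ∪ B) (n A ↑ʳ_) (adj-∪-↑ʳ A B)) ⟨
  k (suc t) A + k (suc t) B ∎
  where
  open ≡-Reasoning
  no-cross : ∀ x y → ¬ Adjacent (A ∪ B) (x ↑ˡ n B) (n A ↑ʳ y)
  no-cross x y x~y = case trans (sym (adj-∪-↑ˡ↑ʳ A B x y)) x~y of λ ()

k-copies-≤ : ∀ t q m → k (suc t) (copies q (K m)) ≤ q * (m C suc t)
k-copies-≤ t zero    m = z≤n
k-copies-≤ t (suc q) m rewrite k-∪ t (K m) (copies q (K m)) =
  +-mono-≤ (k-≤ (suc t) (K m)) (k-copies-≤ t q m)

Iso-refl : ∀ G → Iso G G
Iso-refl G = record { to = id ; from = id ; from-to = λ _ → refl ; to-from = λ _ → refl ; pres = λ _ _ → refl }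

Iso-sym : ∀ {G H} → Iso G H → Iso H G
Iso-sym {G} {H} φ = record
  { to      = from
  ; from    = to
  ; from-to = to-from
  ; to-from = from-to
  ; pres    = λ i j → trans (sym (pres (from i) (from j))) (cong₂ (adj H) (to-from i) (to-from j))
  }
  where open Iso φ

Iso-trans : ∀ {G H J} → Iso G H → Iso H J → Iso G J
Iso-trans φ ψ = record
  { to      = ψ.to ∘ φ.to
  ; from    = φ.from ∘ ψ.from
  ; from-to = λ i → trans (cong φ.from (ψ.from-to (φ.to i))) (φ.from-to i)
  ; to-from = λ j → trans (cong ψ.to (φ.to-from (ψ.from j))) (ψ.to-from j)
  ; pres    = λ i j → trans (ψ.pres (φ.to i) (φ.to j)) (φ.pres i j)
  }
  where
  module φ = Iso φ
  module ψ = Iso ψ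

Iso→↔ : ∀ {G H} → Iso G H → Fin (n G) ↔ Fin (n H)
Iso→↔ φ = mk↔ₛ′ (Iso.to φ) (Iso.from φ) (Iso.to-from φ) (Iso.from-to φ)

-- Isomorphisms between unions are obtained by labelling both sides over a common sum type,
-- so that only the adjacency relations on that type have to be compared.
record Labelling (G : Graph) {X : Set} (R : X → X → Bool) : Set where
  field
    label     : Fin (n G) ↔ X
    adj-label : ∀ i j → adj G i j ≡ R (Inverse.to label i) (Inverse.to label j)

Iso-via : ∀ {G H X} {R : X → X → Bool} → Labelling G R → Labelling H R → Iso G H
Iso-via {G} {H} {R = R} ℓ μ = record
  { to      = μ.from ∘ ℓ.to
  ; from    = ℓ.from ∘ μ.to
  ; from-to = λ i → trans (cong ℓ.from (μ.strictlyInverseˡ (ℓ.to i))) (ℓ.strictlyInverseʳ i)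
  ; to-from = λ j → trans (cong μ.from (ℓ.strictlyInverseˡ (μ.to j))) (μ.strictlyInverseʳ j)
  ; pres    = λ i j → begin
      adj H (μ.from (ℓ.to i)) (μ.from (ℓ.to j))  ≡⟨ Labelling.adj-label μ _ _ ⟩
      R (μ.to (μ.from (ℓ.to i))) (μ.to (μ.from (ℓ.to j)))
                                                 ≡⟨ cong₂ R (μ.strictlyInverseˡ _) (μ.strictlyInverseˡ _) ⟩
      R (ℓ.to i) (ℓ.to j)                        ≡⟨ Labelling.adj-label ℓ i j ⟨
      adj G i j                                  ∎
  }
  where
  open ≡-Reasoning
  module ℓ = Inverse (Labelling.label ℓ)
  module μ = Inverse (Labelling.label μ)

relabel : ∀ {G X Y} {R : X → X → Bool} {S : Y → Y → Bool} → Labelling G R →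
          (f : X ↔ Y) → (∀ x x′ → R x x′ ≡ S (Inverse.to f x) (Inverse.to f x′)) → Labelling G S
relabel ℓ f R⇒S = record
  { label     = ↔-trans (Labelling.label ℓ) f
  ; adj-label = λ i j → trans (Labelling.adj-label ℓ i j) (R⇒S _ _)
  }

⊕-map : ∀ {X X′ Y Y′ : Set} {R : X → X → Bool} {R′ : X′ → X′ → Bool}
          {S : Y → Y → Bool} {S′ : Y′ → Y′ → Bool} {f : X → X′} {g : Y → Y′} →
        (∀ x x′ → R x x′ ≡ R′ (f x) (f x′)) → (∀ y y′ → S y y′ ≡ S′ (g y) (g y′)) →
        ∀ s s′ → (R ⊕ S) s s′ ≡ (R′ ⊕ S′) (Sum.map f g s) (Sum.map f g s′)
⊕-map hf hg (inj₁ x) (inj₁ x′) = hf x x′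
⊕-map hf hg (inj₁ x) (inj₂ y′) = refl
⊕-map hf hg (inj₂ y) (inj₁ x′) = refl
⊕-map hf hg (inj₂ y) (inj₂ y′) = hg y y′

⊕-assoc : ∀ {X Y Z : Set} (R : X → X → Bool) (S : Y → Y → Bool) (U : Z → Z → Bool) →
          ∀ s s′ → ((R ⊕ S) ⊕ U) s s′ ≡ (R ⊕ (S ⊕ U)) (Sum.assocʳ s) (Sum.assocʳ s′)
⊕-assoc R S U (inj₁ (inj₁ x)) (inj₁ (inj₁ x′)) = refl
⊕-assoc R S U (inj₁ (inj₁ x)) (inj₁ (inj₂ y′)) = refl
⊕-assoc R S U (inj₁ (inj₁ x)) (inj₂ z′)        = refl
⊕-assoc R S U (inj₁ (inj₂ y)) (inj₁ (inj₁ x′)) = refl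
⊕-assoc R S U (inj₁ (inj₂ y)) (inj₁ (inj₂ y′)) = refl
⊕-assoc R S U (inj₁ (inj₂ y)) (inj₂ z′)        = refl
⊕-assoc R S U (inj₂ z)        (inj₁ (inj₁ x′)) = refl
⊕-assoc R S U (inj₂ z)        (inj₁ (inj₂ y′)) = refl
⊕-assoc R S U (inj₂ z)        (inj₂ z′)        = refl

∪-labelling : ∀ A B → Labelling (A ∪ B) (adj A ⊕ adj B)
∪-labelling A B = record { label = FinP.+↔⊎ ; adj-label = adj-∪ A B }

edgeless : ℕ → Graph
edgeless m = record { n = m ; adj = λ _ _ → false ; adj-sym = λ _ _ → refl ; adj-irrefl = λ _ → refl }

pad-labelling : ∀ A c → Labelling (pad A c) (adj A ⊕ adj (edgeless c))
pad-labelling A c = record { label = FinP.+↔⊎ ; adj-label = adj-pad }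
  where
  adj-pad : ∀ i j → adj (pad A c) i j ≡ (adj A ⊕ adj (edgeless c)) (splitAt (n A) i) (splitAt (n A) j)
  adj-pad i j with splitAt (n A) i | splitAt (n A) j
  ... | inj₁ x | inj₁ y = refl
  ... | inj₁ x | inj₂ y = refl
  ... | inj₂ x | inj₁ y = refl
  ... | inj₂ x | inj₂ y = refl

pad≅∪edgeless : ∀ A c → Iso (pad A c) (A ∪ edgeless c)
pad≅∪edgeless A c = Iso-via (pad-labelling A c) (∪-labelling A (edgeless c))

∪-cong : ∀ {A B A′ B′} → Iso A B → Iso A′ B′ → Iso (A ∪ A′) (B ∪ B′)
∪-cong {A} {B} {A′} {B′} φ ψ = Iso-via
  (relabel (∪-labelling A A′) (Iso→↔ φ ⊎-↔ Iso→↔ ψ)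
           (⊕-map (λ x y → sym (Iso.pres φ x y)) (λ x y → sym (Iso.pres ψ x y))))
  (∪-labelling B B′)

∪-assoc : ∀ A B D → Iso ((A ∪ B) ∪ D) (A ∪ (B ∪ D))
∪-assoc A B D = Iso-via left right
  where
  left : Labelling ((A ∪ B) ∪ D) (adj A ⊕ (adj B ⊕ adj D))
  left = relabel (relabel {S = (adj A ⊕ adj B) ⊕ adj D} (∪-labelling (A ∪ B) D) (FinP.+↔⊎ ⊎-↔ ↔-refl)
                          (⊕-map (adj-∪ A B) (λ _ _ → refl)))
                 (⊎-assoc _ _ _ _) (⊕-assoc (adj A) (adj B) (adj D))
  right : Labelling (A ∪ (B ∪ D)) (adj A ⊕ (adj B ⊕ adj D))
  right = relabel (∪-labelling A (B ∪ D)) (↔-refl ⊎-↔ FinP.+↔⊎) (⊕-map (λ _ _ → refl) (adj-∪ B D))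

pad-cong : ∀ {A B} c → Iso A B → Iso (pad A c) (pad B c)
pad-cong {A} {B} c φ =
  Iso-trans (pad≅∪edgeless A c) (Iso-trans (∪-cong φ (Iso-refl _)) (Iso-sym (pad≅∪edgeless B c)))

≅-respʳ : ∀ {G H J} → G ≅ H → Iso H J → G ≅ J
≅-respʳ (a , b , φ) ψ = a , b , Iso-trans φ (pad-cong b ψ)

≅-∪ : ∀ {G A A′ B B′} → Iso G (A ∪ B) → Iso A A′ → B ≅ B′ → G ≅ (A′ ∪ B′)
≅-∪ {G} {A} {A′} {B} {B′} φ α (a , b , ψ) = a , b , chain
  where
  chain : Iso (pad G a) (pad (A′ ∪ B′) b)
  chain = Iso-trans (pad≅∪edgeless G a)
         (Iso-trans (∪-cong φ (Iso-refl _))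
         (Iso-trans (∪-assoc A B (edgeless a))
         (Iso-trans (∪-cong α (Iso-trans (Iso-sym (pad≅∪edgeless B a))
                              (Iso-trans ψ (pad≅∪edgeless B′ b))))
         (Iso-trans (Iso-sym (∪-assoc A′ B′ (edgeless b)))
                    (Iso-sym (pad≅∪edgeless (A′ ∪ B′) b))))))

-- Induced subgraphs and vertex deletion

induced : (G : Graph) {m : ℕ} → (Fin m → Fin (n G)) → Graph
induced G {m} e = record
  { n          = m
  ; adj        = λ i j → adj G (e i) (e j)
  ; adj-sym    = λ i j → adj-sym G (e i) (e j)
  ; adj-irrefl = λ i → adj-irrefl G (e i)
  }

k-induced : ∀ t G {m} (e : Fin m → Fin (n G)) → k t (induced G e) ≡ cliquesIn G t (tabulate e)
k-induced t G e = k-embedding t (induced G e) G e (λ _ _ → refl)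

infix 30 _[_]
_[_] : (G : Graph) → (Fin (n G) → Bool) → Graph
G [ p ] = induced G (select p)

module _ (G : Graph) (p : Fin (n G) → Bool) where

  CrossFree : Set
  CrossFree = ∀ i j → adj G (select p i) (select (not ∘ p) j) ≡ false

  crossEdges : ℕ
  crossEdges = ∑ (count p) λ i → ∑ (count (not ∘ p)) λ j → ind (adj G (select p i) (select (not ∘ p) j))

  degree-select : ∀ u → degree G u ≡ ∑ (count p) (λ i → ind (adj G u (select p i)))
                                     + ∑ (count (not ∘ p)) (λ j → ind (adj G u (select (not ∘ p) j)))
  degree-select u = ∑-select (n G) p (ind ∘ adj G u)

  degree-[]-≤ : ∀ i → degree (G [ p ]) i ≤ degree G (select p i)
  degree-[]-≤ i = subst (degree (G [ p ]) i ≤_) (sym (degree-select (select p i))) (m≤m+n _ _)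

  k-split : CrossFree → ∀ t → k (suc t) G ≡ k (suc t) (G [ p ]) + k (suc t) (G [ not ∘ p ])
  k-split cross-free t = begin
    k (suc t) G
      ≡⟨ cliquesIn-↭ G (suc t) (allFin-↭-select (n G) p) ⟩
    cliquesIn G (suc t) (tabulate (select p) ++ tabulate (select (not ∘ p)))
      ≡⟨ cliquesIn-++ G t _ _ (tabulate⁺ λ i → tabulate⁺ λ j → no-cross i j) ⟩
    cliquesIn G (suc t) (tabulate (select p)) + cliquesIn G (suc t) (tabulate (select (not ∘ p)))
      ≡⟨ cong₂ _+_ (k-induced (suc t) G (select p)) (k-induced (suc t) G (select (not ∘ p))) ⟨
    k (suc t) (G [ p ]) + k (suc t) (G [ not ∘ p ]) ∎
    where
    open ≡-Reasoning
    no-cross : ∀ i j → ¬ Adjacent G (select p i) (select (not ∘ p) j)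
    no-cross i j i~j = case trans (sym (cross-free i j)) i~j of λ ()

  split-iso : CrossFree → Iso G (G [ p ] ∪ G [ not ∘ p ])
  split-iso cross-free = Iso-via (record { label = select-↔ p ; adj-label = adj-label }) (∪-labelling _ _)
    where
    module σ = Inverse (select-↔ p)
    adj-from : ∀ s s′ → adj G (σ.from s) (σ.from s′) ≡ (adj (G [ p ]) ⊕ adj (G [ not ∘ p ])) s s′
    adj-from (inj₁ i) (inj₁ i′) = refl
    adj-from (inj₁ i) (inj₂ j′) = cross-free i j′
    adj-from (inj₂ j) (inj₁ i′) = trans (adj-sym G _ _) (cross-free i′ j)
    adj-from (inj₂ j) (inj₂ j′) = refl
    adj-label : ∀ u w → adj G u w ≡ (adj (G [ p ]) ⊕ adj (G [ not ∘ p ])) (σ.to u) (σ.to w)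
    adj-label u w = trans (sym (cong₂ (adj G) (σ.strictlyInverseʳ u) (σ.strictlyInverseʳ w)))
                          (adj-from (σ.to u) (σ.to w))

  edges-split : edges G ≡ edges (G [ p ]) + edges (G [ not ∘ p ]) + crossEdges
  edges-split = *-cancelˡ-≡ _ _ 2 (begin
    2 * edges G
      ≡⟨ handshake G ⟩
    ∑ (n G) (degree G)
      ≡⟨ ∑-select (n G) p (degree G) ⟩
    ∑ a (degree G ∘ select p) + ∑ b (degree G ∘ select q)
      ≡⟨ cong₂ _+_ (∑-cong a (degree-select ∘ select p)) (∑-cong b (degree-select ∘ select q)) ⟩
    ∑ a (λ i → degree (G [ p ]) i + X i) + ∑ b (λ j → Y j + degree (G [ q ]) j)
      ≡⟨ cong₂ _+_ (∑-+ a _ X) (∑-+ b Y _) ⟩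
    (∑ a (degree (G [ p ])) + crossEdges) + (∑ b Y + ∑ b (degree (G [ q ])))
      ≡⟨ cong₂ (λ x y → (∑ a (degree (G [ p ])) + crossEdges) + (x + y))
               ∑Y≡cross (sym (handshake (G [ q ]))) ⟩
    (∑ a (degree (G [ p ])) + crossEdges) + (crossEdges + 2 * edges (G [ q ]))
      ≡⟨ cong (λ x → (x + crossEdges) + (crossEdges + 2 * edges (G [ q ]))) (sym (handshake (G [ p ]))) ⟩
    (2 * edges (G [ p ]) + crossEdges) + (crossEdges + 2 * edges (G [ q ]))
      ≡⟨ regroup (edges (G [ p ])) (edges (G [ q ])) crossEdges ⟩
    2 * (edges (G [ p ]) + edges (G [ q ]) + crossEdges) ∎)
    where
    open ≡-Reasoning
    q = not ∘ p
    a = count p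
    b = count q
    X : Fin a → ℕ
    X i = ∑ b (λ j → ind (adj G (select p i) (select q j)))
    Y : Fin b → ℕ
    Y j = ∑ a (λ i → ind (adj G (select q j) (select p i)))
    ∑Y≡cross : ∑ b Y ≡ crossEdges
    ∑Y≡cross = trans (sym (∑-swap a b λ i j → ind (adj G (select q j) (select p i))))
                     (∑-cong a λ i → ∑-cong b λ j → cong ind (adj-sym G _ _))
    regroup : ∀ x y c → (2 * x + c) + (c + 2 * y) ≡ 2 * (x + y + c)
    regroup = solve-∀

edges-edgeless : ∀ H → (∀ i j → adj H i j ≡ false) → edges H ≡ 0
edges-edgeless H no-adj = trans (∑-cong (n H) λ i → trans (∑-cong (n H) (no-edge i)) (∑-zero (n H))) (∑-zero (n H))
  where
  no-edge : ∀ i j → ind ((toℕ i <ᵇ toℕ j) ∧ adj H i j) ≡ 0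
  no-edge i j rewrite no-adj i j | BoolP.∧-zeroʳ (toℕ i <ᵇ toℕ j) = refl

tabulate-single : ∀ {ℓ} {X : Set ℓ} {m} (f : Fin m → X) {x} → m ≡ 1 → (∀ i → f i ≡ x) →
                  tabulate f ≡ x ∷ []
tabulate-single f refl f≡x = cong (_∷ []) (f≡x zero)

isVertex : ∀ {m} → Fin m → Fin m → Bool
isVertex v u = does (u Fin.≟ v)

∑-isVertex : ∀ {m} (v : Fin m) → ∑ m (ind ∘ isVertex v) ≡ 1
∑-isVertex {m} v = begin
  ∑ m (ind ∘ isVertex v)   ≡⟨ ∑-point m _ v (λ u u≢v → cong ind (dec-false (u Fin.≟ v) u≢v)) ⟩
  ind (isVertex v v)       ≡⟨ cong ind (dec-true (v Fin.≟ v) refl) ⟩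
  1                        ∎
  where open ≡-Reasoning

infixl 30 _─_
_─_ : (G : Graph) → Fin (n G) → Graph
G ─ v = G [ not ∘ isVertex v ]

module _ (G : Graph) (v : Fin (n G)) where

  otherVertices : List (Fin (n G))
  otherVertices = tabulate (select (not ∘ isVertex v))

  neighbourhood : List (Fin (n G))
  neighbourhood = neighbours G v otherVertices

  select-isVertex : ∀ i → select (isVertex v) i ≡ v
  select-isVertex i with select (isVertex v) i Fin.≟ v | select-sound (isVertex v) i
  ... | yes e | _ = e

  count-isVertex : count (isVertex v) ≡ 1
  count-isVertex = trans (count≡∑ (isVertex v)) (∑-isVertex v)

  n-─ : n G ≡ suc (n (G ─ v))
  n-─ = begin
    n G                                     ≡⟨ ∑-one (n G) ⟨
    ∑ (n G) (λ _ → 1)                       ≡⟨ ∑-select (n G) (isVertex v) (λ _ → 1) ⟩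
    ∑ (count (isVertex v)) (λ _ → 1) + ∑ (n (G ─ v)) (λ _ → 1)
                                            ≡⟨ cong₂ _+_ (trans (∑-one _) count-isVertex) (∑-one (n (G ─ v))) ⟩
    suc (n (G ─ v))                         ∎
    where open ≡-Reasoning

  degree≡∑-others : degree G v ≡ ∑ (n (G ─ v)) (λ j → ind (adj G v (select (not ∘ isVertex v) j)))
  degree≡∑-others = trans (degree-select G (isVertex v) v) (cong (_+ to-others) no-loop)
    where
    to-others = ∑ (n (G ─ v)) (λ j → ind (adj G v (select (not ∘ isVertex v) j)))
    no-loop : ∑ (count (isVertex v)) (λ i → ind (adj G v (select (isVertex v) i))) ≡ 0
    no-loop = trans (∑-cong (count (isVertex v)) λ i →
                       cong ind (trans (cong (adj G v) (select-isVertex i)) (adj-irrefl G v)))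
                    (∑-zero (count (isVertex v)))

  length-neighbourhood : length neighbourhood ≡ degree G v
  length-neighbourhood = trans (length-neighbours-tabulate G v (select (not ∘ isVertex v))) (sym degree≡∑-others)

  k-─ : ∀ t → k (suc t) G ≡ k (suc t) (G ─ v) + cliquesIn G t neighbourhood
  k-─ t = begin
    k (suc t) G
      ≡⟨ cliquesIn-↭ G (suc t) (allFin-↭-select (n G) (isVertex v)) ⟩
    cliquesIn G (suc t) (tabulate (select (isVertex v)) ++ otherVertices)
      ≡⟨ cong (λ xs → cliquesIn G (suc t) (xs ++ otherVertices)) (tabulate-single _ count-isVertex select-isVertex) ⟩
    cliquesIn G (suc t) (v ∷ otherVertices)
      ≡⟨ cong (_+ cliquesIn G t neighbourhood) (k-induced (suc t) G (select (not ∘ isVertex v))) ⟨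
    k (suc t) (G ─ v) + cliquesIn G t neighbourhood ∎
    where open ≡-Reasoning

  edges-─ : edges G ≡ edges (G ─ v) + degree G v
  edges-─ = begin
    edges G
      ≡⟨ edges-split G (isVertex v) ⟩
    edges (G [ isVertex v ]) + edges (G ─ v) + crossEdges G (isVertex v)
      ≡⟨ cong₂ (λ x y → x + edges (G ─ v) + y) (edges-edgeless (G [ isVertex v ]) loop) cross≡degree ⟩
    edges (G ─ v) + degree G v ∎
    where
    open ≡-Reasoning
    loop : ∀ i j → adj G (select (isVertex v) i) (select (isVertex v) j) ≡ false
    loop i j rewrite select-isVertex i | select-isVertex j = adj-irrefl G v
    cross≡degree : crossEdges G (isVertex v) ≡ degree G v
    cross≡degree = begin
      crossEdges G (isVertex v)                   ≡⟨ ∑-cong (count (isVertex v)) row≡degree ⟩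
      ∑ (count (isVertex v)) (λ _ → degree G v)   ≡⟨ ∑-const (count (isVertex v)) (degree G v) ⟩
      count (isVertex v) * degree G v             ≡⟨ cong (_* degree G v) count-isVertex ⟩
      degree G v + 0                              ≡⟨ +-identityʳ _ ⟩
      degree G v                                  ∎
      where
      row≡degree : ∀ i →
        ∑ (n (G ─ v)) (λ j → ind (adj G (select (isVertex v) i) (select (not ∘ isVertex v) j))) ≡ degree G v
      row≡degree i = trans (cong (λ u → ∑ (n (G ─ v)) (λ j → ind (adj G u (select (not ∘ isVertex v) j))))
                                 (select-isVertex i))
                           (sym degree≡∑-others)

∑-below : ∀ m s → s ≤ m → ∑ m (λ (j : Fin m) → ind (toℕ j <ᵇ s)) ≡ s
∑-below m       zero    _         = trans (∑-cong m λ j → cong ind (<ᵇ-false {toℕ j} z≤n)) (∑-zero m)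
∑-below (suc m) (suc s) (s≤s s≤m) = cong suc (∑-below m s s≤m)

degree-L-last : ∀ r s → s ≤ r → degree (L r s) (Fin.fromℕ r) ≡ s
degree-L-last r s s≤r = trans (∑-cong (suc r) adj≡below) (∑-below (suc r) s (m≤n⇒m≤1+n s≤r))
  where
  w = Fin.fromℕ r
  adj≡below : ∀ j → ind (distinct w j ∧ colexP r s w j) ≡ ind (toℕ j <ᵇ s)
  adj≡below j rewrite FinP.toℕ-fromℕ r | <ᵇ-false {r} {r} ≤-refl | <ᵇ-false {r} {s} s≤r with toℕ j <? s
  ... | yes j<s rewrite <ᵇ-true j<s | dec-false (w Fin.≟ j) (λ w≡j → <⇒≢ (<-≤-trans j<s s≤r)
                                                                (trans (cong toℕ (sym w≡j)) (FinP.toℕ-fromℕ r)))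
                  = refl
  ... | no  j≮s rewrite <ᵇ-false (≮⇒≥ j≮s) | BoolP.∧-zeroʳ (distinct w j) = refl

k-L-≤ : ∀ t r s → s ≤ r → k (suc t) (L r s) ≤ r C suc t + s C t
k-L-≤ t r s s≤r = begin
  k (suc t) (L r s)
    ≡⟨ k-─ (L r s) w t ⟩
  k (suc t) (L r s ─ w) + cliquesIn (L r s) t (neighbourhood (L r s) w)
    ≤⟨ +-mono-≤ (k-≤ (suc t) (L r s ─ w)) (cliquesIn-≤ (L r s) t _) ⟩
  n (L r s ─ w) C suc t + length (neighbourhood (L r s) w) C t
    ≡⟨ cong₂ (λ a b → a C suc t + b C t) (suc-injective (sym (n-─ (L r s) w)))
             (trans (length-neighbourhood (L r s) w) (degree-L-last r s s≤r)) ⟩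
  r C suc t + s C t ∎
  where
  open ≤-Reasoning
  w = Fin.fromℕ r

k-extremal-≤ : ∀ t q m r s → s ≤ r →
  k (suc t) (copies q (K m) ∪ L r s) ≤ q * (m C suc t) + (r C suc t + s C t)
k-extremal-≤ t q m r s s≤r rewrite k-∪ t (copies q (K m)) (L r s) =
  +-mono-≤ (k-copies-≤ t q m) (k-L-≤ t r s s≤r)

IsComplete : Graph → Set
IsComplete H = ∀ i j → i ≢ j → adj H i j ≡ true

k-complete : ∀ t G → IsComplete G → k t G ≡ n G C t
k-complete t G complete = trans
  (cliquesIn-clique G t (allFin (n G)) (AllPairs.map (complete _ _) (allFin⁺ (n G))))
  (cong (_C t) (length-tabulate id))

degree-complete : ∀ H → IsComplete H → ∀ i → suc (degree H i) ≡ n H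
degree-complete H complete i = begin
  suc (degree H i)                                            ≡⟨ cong (_+ degree H i) (∑-isVertex i) ⟨
  ∑ (n H) (ind ∘ isVertex i) + degree H i                     ≡⟨ ∑-+ (n H) _ _ ⟨
  ∑ (n H) (λ j → ind (isVertex i j) + ind (adj H i j))        ≡⟨ ∑-cong (n H) one ⟩
  ∑ (n H) (λ _ → 1)                                           ≡⟨ ∑-one (n H) ⟩
  n H                                                         ∎
  where
  open ≡-Reasoning
  one : ∀ j → ind (isVertex i j) + ind (adj H i j) ≡ 1
  one j with j Fin.≟ i
  ... | yes refl rewrite adj-irrefl H j = refl
  ... | no  j≢i  rewrite complete i j (j≢i ∘ sym) = refl

2*nC2≡n*pred[n] : ∀ m → 2 * (m C 2) ≡ m * pred m
2*nC2≡n*pred[n] zero          = refl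
2*nC2≡n*pred[n] (suc zero)    = refl
2*nC2≡n*pred[n] (suc (suc m)) = begin
  2 * (suc (suc m) C 2)               ≡⟨ cong (2 *_) (C-suc (suc m) 1) ⟩
  2 * (suc m C 1 + suc m C 2)         ≡⟨ cong (λ c → 2 * (c + suc m C 2)) (nC1≡n (suc m)) ⟩
  2 * (suc m + suc m C 2)             ≡⟨ *-distribˡ-+ 2 (suc m) _ ⟩
  2 * suc m + 2 * (suc m C 2)         ≡⟨ cong (2 * suc m +_) (2*nC2≡n*pred[n] (suc m)) ⟩
  2 * suc m + suc m * m               ≡⟨ expand m ⟩
  suc (suc m) * suc m                 ∎
  where
  open ≡-Reasoning
  expand : ∀ m → 2 * suc m + suc m * m ≡ suc (suc m) * suc m
  expand = solve-∀

edges-complete : ∀ H → IsComplete H → edges H ≡ n H C 2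
edges-complete H complete = *-cancelˡ-≡ _ _ 2 (begin
  2 * edges H                       ≡⟨ handshake H ⟩
  ∑ (n H) (degree H)                ≡⟨ ∑-cong (n H) (λ i → cong pred (degree-complete H complete i)) ⟩
  ∑ (n H) (λ _ → pred (n H))        ≡⟨ ∑-const (n H) _ ⟩
  n H * pred (n H)                  ≡⟨ 2*nC2≡n*pred[n] (n H) ⟨
  2 * (n H C 2)                     ∎)
  where open ≡-Reasoning

Iso-complete : ∀ H {m} → n H ≡ m → IsComplete H → Iso H (K m)
Iso-complete H refl complete = record
  { to = id ; from = id ; from-to = λ _ → refl ; to-from = λ _ → refl ; pres = pres }
  where
  pres : ∀ i j → distinct i j ∧ true ≡ adj H i j
  pres i j with i Fin.≟ j
  ... | yes refl = sym (adj-irrefl H i)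
  ... | no  i≢j  = sym (complete i j i≢j)

-- A minimum counterexample with r = 1

module _ {t₁ Δ G q} (2≤t₁ : 2 ≤ t₁) (t₁≤Δ : t₁ ≤ Δ)
         (mc : MinimumCounterexample (suc t₁) Δ G (suc q) 1 0) where

  open MinimumCounterexample mc

  private
    t D Kt : ℕ
    t  = suc t₁
    D  = suc Δ C 2
    Kt = suc Δ C t

    1≤t₁ : 1 ≤ t₁
    1≤t₁ = ≤-trans (s≤s z≤n) 2≤t₁

    1≤D : 1 ≤ D
    1≤D = C-pos (s≤s (≤-trans 1≤t₁ t₁≤Δ))

  edges-G : edges G ≡ D + q * D
  edges-G = trans size (+-identityʳ _)

  many-G : Kt + q * Kt ≤ k t G
  many-G = subst (_≤ k t G) no-tail many
    where
    no-tail : suc q * Kt + 1 C t + 0 C t₁ ≡ Kt + q * Kt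
    no-tail rewrite k>n⇒nCk≡0 {1} {t} (s≤s 1≤t₁) | k>n⇒nCk≡0 {0} {t₁} 1≤t₁ =
      trans (+-identityʳ _) (+-identityʳ _)

  module _ (v : Fin (n G)) (1≤d : 1 ≤ degree G v) where

    private
      d : ℕ
      d = degree G v

      d≤Δ : d ≤ Δ
      d≤Δ = maxdeg v

    edges-G─v : edges (G ─ v) ≡ q * D + (Δ C 2 + (Δ ∸ d))
    edges-G─v = +-cancelʳ-≡ d _ _ (begin
      edges (G ─ v) + d                      ≡⟨ edges-─ G v ⟨
      edges G                                ≡⟨ edges-G ⟩
      D + q * D                              ≡⟨ cong (_+ q * D) (C-suc′ Δ 1) ⟩
      Δ C 2 + Δ C 1 + q * D                  ≡⟨ cong (λ c → Δ C 2 + c + q * D)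
                                                     (trans (nC1≡n Δ) (sym (m∸n+n≡m d≤Δ))) ⟩
      Δ C 2 + ((Δ ∸ d) + d) + q * D          ≡⟨ regroup (Δ C 2) (Δ ∸ d) d (q * D) ⟩
      q * D + (Δ C 2 + (Δ ∸ d)) + d          ∎)
      where
      open ≡-Reasoning
      regroup : ∀ a b c e → a + (b + c) + e ≡ e + (a + b) + c
      regroup = solve-∀

    k-G─v-≤ : k t (G ─ v) ≤ q * Kt + (Δ C t + (Δ ∸ d) C t₁)
    k-G─v-≤ = ≤-trans (proj₁ (minimal (G ─ v) maxdeg-G─v fewer q Δ (Δ ∸ d) Δ∸d<Δ ≤-refl edges-G─v))
                      (k-extremal-≤ t₁ q (suc Δ) Δ (Δ ∸ d) (m∸n≤m Δ d))
      where
      maxdeg-G─v : MaxDeg≤ (G ─ v) Δ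
      maxdeg-G─v j = ≤-trans (degree-[]-≤ G (not ∘ isVertex v) j) (maxdeg _)
      fewer : edges (G ─ v) < edges G
      fewer = subst (edges (G ─ v) <_) (sym (edges-─ G v)) (m<m+n (edges (G ─ v)) 1≤d)
      Δ∸d<Δ : Δ ∸ d < Δ
      Δ∸d<Δ = ∸-monoʳ-< {Δ} {d} {0} 1≤d d≤Δ

    -- Minimality bounds k_t(G − v); the cliques through v must make up the rest of k_t(G).
    deletion-bound : Δ C t₁ ≤ (Δ ∸ d) C t₁ + cliquesIn G t₁ (neighbourhood G v)
    deletion-bound = +-cancelʳ-≤ (Δ C t + q * Kt) _ _ (begin
      Δ C t₁ + (Δ C t + q * Kt)              ≡⟨ +-assoc (Δ C t₁) (Δ C t) (q * Kt) ⟨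
      Δ C t₁ + Δ C t + q * Kt                ≡⟨ cong (_+ q * Kt) (C-suc Δ t₁) ⟨
      Kt + q * Kt                            ≤⟨ many-G ⟩
      k t G                                  ≡⟨ k-─ G v t₁ ⟩
      k t (G ─ v) + c                        ≤⟨ +-monoˡ-≤ c k-G─v-≤ ⟩
      q * Kt + (Δ C t + A) + c               ≡⟨ regroup (q * Kt) (Δ C t) A c ⟩
      A + c + (Δ C t + q * Kt)               ∎)
      where
      open ≤-Reasoning
      A = (Δ ∸ d) C t₁
      c = cliquesIn G t₁ (neighbourhood G v)
      regroup : ∀ a b e f → a + (b + e) + f ≡ e + f + (b + a)
      regroup = solve-∀

    degree≡Δ : d ≡ Δ
    degree≡Δ = ≤-antisym d≤Δ (≮⇒≥ λ d<Δ → <-irrefl refl (begin-strict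
      Δ C t₁                                 ≤⟨ deletion-bound ⟩
      (Δ ∸ d) C t₁ + cliquesIn G t₁ (neighbourhood G v)
                                             ≤⟨ +-monoʳ-≤ _ through-v≤ ⟩
      (Δ ∸ d) C t₁ + d C t₁                  <⟨ C-superadditive-< (m<n⇒0<n∸m d<Δ) 1≤d 2≤t₁
                                                                  (≤-trans t₁≤Δ (≤-reflexive Δ≡)) ⟩
      ((Δ ∸ d) + d) C t₁                     ≡⟨ cong (_C t₁) Δ≡ ⟨
      Δ C t₁                                 ∎))
      where
      open ≤-Reasoning
      Δ≡ : Δ ≡ (Δ ∸ d) + d
      Δ≡ = sym (m∸n+n≡m d≤Δ)
      through-v≤ : cliquesIn G t₁ (neighbourhood G v) ≤ d C t₁
      through-v≤ = subst (λ m → cliquesIn G t₁ (neighbourhood G v) ≤ m C t₁) (length-neighbourhood G v)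
                         (cliquesIn-≤ G t₁ (neighbourhood G v))

    neighbourhood-clique : AllPairs (Adjacent G) (neighbourhood G v)
    neighbourhood-clique = cliquesIn-extremal G t₁ (neighbourhood G v) 2≤t₁
      (subst (t₁ ≤_) (sym length≡Δ) t₁≤Δ)
      (subst (λ m → m C t₁ ≤ c) (sym length≡Δ) Δ-tight)
      where
      c = cliquesIn G t₁ (neighbourhood G v)
      length≡Δ : length (neighbourhood G v) ≡ Δ
      length≡Δ = trans (length-neighbourhood G v) degree≡Δ
      Δ∸d≡0 : Δ ∸ d ≡ 0
      Δ∸d≡0 = trans (cong (Δ ∸_) degree≡Δ) (n∸n≡0 Δ)
      Δ-tight : Δ C t₁ ≤ c
      Δ-tight = subst (λ z → Δ C t₁ ≤ z + c) (k>n⇒nCk≡0 {0} {t₁} 1≤t₁)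
                  (subst (λ m → Δ C t₁ ≤ m C t₁ + c) Δ∸d≡0 deletion-bound)

    closed : Fin (n G) → Bool
    closed u = isVertex v u ∨ adj G v u

    private
      closed-cases : ∀ u → closed u ≡ true → u ≡ v ⊎ adj G v u ≡ true
      closed-cases u cu with u Fin.≟ v
      ... | yes u≡v = inj₁ u≡v
      ... | no  _   = inj₂ cu

      ∈-neighbourhood : ∀ u → adj G v u ≡ true → u ∈ neighbourhood G v
      ∈-neighbourhood u v~u = ∈-filter⁺ (adjacent? G v) u∈others v~u
        where
        u≢v : u ≢ v
        u≢v u≡v = case trans (sym v~u) (trans (cong (adj G v) u≡v) (adj-irrefl G v)) of λ ()
        u∈others : u ∈ otherVertices G v
        u∈others = let j , e = select-complete (not ∘ isVertex v) u (cong not (dec-false (u Fin.≟ v) u≢v))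
                   in subst (_∈ otherVertices G v) e (∈-tabulate⁺ j)

    closed-complete : IsComplete (G [ closed ])
    closed-complete i j i≢j with closed-cases _ (select-sound closed i) | closed-cases _ (select-sound closed j)
    ... | inj₁ x≡v | inj₁ y≡v = ⊥-elim (i≢j (select-injective closed (trans x≡v (sym y≡v))))
    ... | inj₁ x≡v | inj₂ v~y = subst (λ u → adj G u (select closed j) ≡ true) (sym x≡v) v~y
    ... | inj₂ v~x | inj₁ y≡v =
      trans (adj-sym G _ _) (subst (λ u → adj G u (select closed i) ≡ true) (sym y≡v) v~x)
    ... | inj₂ v~x | inj₂ v~y = AllPairs-∈ (λ {a} {b} e → trans (adj-sym G b a) e) neighbourhood-clique
                                  (∈-neighbourhood _ v~x) (∈-neighbourhood _ v~y) (i≢j ∘ select-injective closed)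

    count-closed : count closed ≡ suc Δ
    count-closed = begin
      count closed                                              ≡⟨ count≡∑ closed ⟩
      ∑ (n G) (ind ∘ closed)                                    ≡⟨ ∑-cong (n G) split-ind ⟩
      ∑ (n G) (λ u → ind (isVertex v u) + ind (adj G v u))      ≡⟨ ∑-+ (n G) _ _ ⟩
      ∑ (n G) (ind ∘ isVertex v) + d                            ≡⟨ cong₂ _+_ (∑-isVertex v) degree≡Δ ⟩
      suc Δ                                                     ∎
      where
      open ≡-Reasoning
      split-ind : ∀ u → ind (closed u) ≡ ind (isVertex v u) + ind (adj G v u)
      split-ind u with u Fin.≟ v
      ... | yes refl rewrite adj-irrefl G u = refl
      ... | no  _    = refl

    closed-cross-free : CrossFree G closed
    closed-cross-free i j = ind≡0 (∑≡0 _ _ outside≡0 j)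
      where
      outside : ℕ
      outside = ∑ (count (not ∘ closed)) (λ j → ind (adj G (select closed i) (select (not ∘ closed) j)))
      Δ+outside≤Δ : Δ + outside ≤ Δ
      Δ+outside≤Δ = subst (_≤ Δ)
        (trans (degree-select G closed (select closed i)) (cong (_+ outside) degree-inside))
        (maxdeg (select closed i))
        where
        degree-inside : degree (G [ closed ]) i ≡ Δ
        degree-inside = suc-injective (trans (degree-complete (G [ closed ]) closed-complete i) count-closed)
      outside≡0 : outside ≡ 0
      outside≡0 = n≤0⇒n≡0 (+-cancelˡ-≤ Δ outside 0
                    (subst (Δ + outside ≤_) (sym (+-identityʳ Δ)) Δ+outside≤Δ))

    private
      F : Graph
      F = G [ not ∘ closed ]

    edges-F : edges F ≡ q * D
    edges-F = +-cancelˡ-≡ D _ _ (begin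
      D + edges F                                           ≡⟨ cong (_+ edges F) edges-closed ⟨
      edges (G [ closed ]) + edges F                        ≡⟨ +-identityʳ _ ⟨
      edges (G [ closed ]) + edges F + 0                    ≡⟨ cong (edges (G [ closed ]) + edges F +_) cross≡0 ⟨
      edges (G [ closed ]) + edges F + crossEdges G closed  ≡⟨ edges-split G closed ⟨
      edges G                                               ≡⟨ edges-G ⟩
      D + q * D                                             ∎)
      where
      open ≡-Reasoning
      edges-closed : edges (G [ closed ]) ≡ D
      edges-closed = trans (edges-complete (G [ closed ]) closed-complete) (cong (_C 2) count-closed)
      cross≡0 : crossEdges G closed ≡ 0
      cross≡0 = trans (∑-cong (count closed) λ i →
                          trans (∑-cong _ λ j → cong ind (closed-cross-free i j)) (∑-zero (count (not ∘ closed))))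
                        (∑-zero (count closed))

    k-F-≥ : q * Kt ≤ k t F
    k-F-≥ = +-cancelˡ-≤ Kt _ _ (subst (Kt + q * Kt ≤_) k-G many-G)
      where
      k-G : k t G ≡ Kt + k t F
      k-G = trans (k-split G closed closed-cross-free t₁)
                  (cong (_+ k t F) (trans (k-complete t (G [ closed ]) closed-complete) (cong (_C t) count-closed)))

    F-extremal : Σ Graph λ H → InFamily t Δ 1 0 H × F ≅ (copies q (K (suc Δ)) ∪ H)
    F-extremal = proj₂ minimality (≤-antisym (proj₁ minimality) (≤-trans extremal-≤ k-F-≥))
      where
      maxdeg-F : MaxDeg≤ F Δ
      maxdeg-F j = ≤-trans (degree-[]-≤ G (not ∘ closed) j) (maxdeg _)
      fewer : edges F < edges G
      fewer = subst₂ _<_ (sym edges-F) (sym edges-G) (+-monoˡ-≤ (q * D) 1≤D)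
      size-F : edges F ≡ q * D + (1 C 2 + 0)
      size-F = trans edges-F (sym (+-identityʳ _))
      extremal-≤ : k t (copies q (K (suc Δ)) ∪ L 1 0) ≤ q * Kt
      extremal-≤ = subst (k t (copies q (K (suc Δ)) ∪ L 1 0) ≤_) no-tail (k-extremal-≤ t₁ q (suc Δ) 1 0 z≤n)
        where
        no-tail : q * Kt + (1 C t + 0 C t₁) ≡ q * Kt
        no-tail rewrite k>n⇒nCk≡0 {1} {t} (s≤s 1≤t₁) | k>n⇒nCk≡0 {0} {t₁} 1≤t₁ = +-identityʳ _
      minimality = minimal F maxdeg-F fewer q 1 0 (s≤s z≤n) (≤-trans 1≤t₁ t₁≤Δ) size-F

    G-decomposes : Σ Graph λ H → InFamily t Δ 1 0 H × G ≅ (copies (suc q) (K (suc Δ)) ∪ H)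
    G-decomposes = H , H∈ , ≅-respʳ (≅-∪ (split-iso G closed closed-cross-free)
                                         (Iso-complete (G [ closed ]) count-closed closed-complete) F≅)
                                    (Iso-sym (∪-assoc (K (suc Δ)) (copies q (K (suc Δ))) H))
      where
      H = proj₁ F-extremal
      H∈ = proj₁ (proj₂ F-extremal)
      F≅ = proj₂ (proj₂ F-extremal)

  positive-degree-vertex : ∃ λ v → 1 ≤ degree G v
  positive-degree-vertex = ∑-pos (n G) (degree G) (subst (0 <_) (handshake G) (begin-strict
    0                 <⟨ 1≤D ⟩
    D                 ≤⟨ m≤m+n D (q * D) ⟩
    D + q * D         ≡⟨ edges-G ⟨
    edges G           ≤⟨ m≤m+n (edges G) _ ⟩
    2 * edges G       ∎))
    where open ≤-Reasoning

¬MinimumCounterexample-r≡1 : ∀ {t Δ G q s} → 3 ≤ t → t ≤ Δ + 1 → ¬ MinimumCounterexample t Δ G q 1 s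
¬MinimumCounterexample-r≡1 {suc t₁} {Δ} {q = suc q} {zero} (s≤s 2≤t₁) t≤Δ+1 mc =
  let v , 1≤d = positive-degree-vertex 2≤t₁ t₁≤Δ mc in
  MinimumCounterexample.notExt mc (G-decomposes 2≤t₁ t₁≤Δ mc v 1≤d)
  where
  t₁≤Δ : t₁ ≤ Δ
  t₁≤Δ = ≤-pred (subst (suc t₁ ≤_) (+-comm Δ 1) t≤Δ+1)
¬MinimumCounterexample-r≡1 {q = zero}  _ _ mc = n≮0 (MinimumCounterexample.q≥1 mc)
¬MinimumCounterexample-r≡1 {s = suc s} _ _ mc with MinimumCounterexample.s<r mc
... | s≤s ()

lemma2p1 : ∀ (t Δ : ℕ) → 3 ≤ t → t ≤ Δ + 1 →
    ∀ (G : Graph) (q r s : ℕ) → MinimumCounterexample t Δ G q r s → 2 ≤ r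
lemma2p1 t Δ 3≤t t≤Δ+1 G q zero          s mc = contradiction (MinimumCounterexample.s<r mc) n≮0
lemma2p1 t Δ 3≤t t≤Δ+1 G q (suc zero)    s mc = ⊥-elim (¬MinimumCounterexample-r≡1 3≤t t≤Δ+1 mc)
lemma2p1 t Δ 3≤t t≤Δ+1 G q (suc (suc r)) s mc = s≤s (s≤s z≤n)
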